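{- For all integers $d,t,n$ with $2\le t\le d$ and $t<n$, $$\frac{d!}{(d-t)!}\cdot\frac{(d-t+1)^{n-t}}{d-t+2}\le \gamma(cDB^+(d,t,n))\le \frac{(d-1)(d-1)!}{(d-t)!}(d-t+1)^{n-t-1},$$ and the upper bound equals $\Bigl(1+\Theta\bigl(\tfrac{t}{d(d-t+1)}\bigr)\Bigr)\frac{d!}{(d-t)!}\cdot\frac{(d-t+1)^{n-t}}{d-t+2}$.
   Context: Let $[d]=\{1,\dots,d\}$. A sequence $(x_1,\dots,x_n)\in[d]^n$ is $t$-constrained if for all $1\le i<j\le n$ with $x_i=x_j$ one has $j-i\ge t$. For $1\le t\le\min\{d,n\}$, $V(d,t,n)$ denotes the set of $t$-constrained sequences in $[d]^n$. The directed $t$-constrained de Bruijn graph $cDB^+(d,t,n)$ has vertex set $V(d,t,n)$ and an arc from $(a_1,\dots,a_n)$ to $(a_2,\dots,a_n,a_{n+1})$ whenever both sequences lie in $V(d,t,n)$. In a directed graph a vertex dominates itself and its out-neighbours; a dominating set is a set $S$ of vertices such that every vertex is dominated by some vertex of $S$, and $\gamma(G)$ is the minimum size of a dominating set. -}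

module Defs where

open import Data.Nat using (ℕ; zero; suc; _≤_; _<_; _∸_; _+_; _*_; _^_; _!)
open import Data.Fin using (Fin; toℕ)
open import Data.Vec using (Vec; lookup; _∷_; _∷ʳ_)
open import Data.List using (List; length)
open import Data.List.Membership.Propositional using (_∈_)
open import Data.List.Relation.Unary.All using (All)
open import Data.List.Relation.Unary.Unique.Propositional using (Unique)
open import Data.Product using (Σ; ∃; ∃-syntax; _×_)
open import Data.Sum using (_⊎_)
open import Data.Empty using (⊥)
open import Relation.Binary.PropositionalEquality using (_≡_)

-- Sequences in [d]^n are vectors of length n over Fin d (symbol k+1 ↦ Fin element k).
Seq : ℕ → ℕ → Set
Seq d n = Vec (Fin d) n

Constrained : ∀ {d n} → ℕ → Seq d n → Set
Constrained {d} {n} t x =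
  ∀ (i j : Fin n) → toℕ i < toℕ j → lookup x i ≡ lookup x j → t ≤ toℕ j ∸ toℕ i

Shift : ∀ {d n} → Seq d n → Seq d n → Set
Shift {d} {zero} u v = ⊥
Shift {d} {suc m} u v =
  Σ (Fin d) λ a → Σ (Fin d) λ b → Σ (Seq d m) λ w → (u ≡ a ∷ w) × (v ≡ w ∷ʳ b)

Arc : ∀ {d n} → ℕ → Seq d n → Seq d n → Set
Arc t u v = Constrained t u × Constrained t v × Shift u v

Dominates : ∀ {d n} → ℕ → Seq d n → Seq d n → Set
Dominates t u v = (u ≡ v) ⊎ Arc t u v

IsDominatingSet : (d t n : ℕ) → List (Seq d n) → Set
IsDominatingSet d t n S =
  Unique S × All (Constrained t) S ×
  (∀ (v : Seq d n) → Constrained t v → ∃[ u ] (u ∈ S × Dominates t u v))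

IsDominationNumber : (d t n : ℕ) → ℕ → Set
IsDominationNumber d t n k =
  (∃[ S ] (IsDominatingSet d t n S × length S ≡ k)) ×
  (∀ S → IsDominatingSet d t n S → k ≤ length S)

-- Upper bound  (d-1)(d-1)!/(d-t)! · (d-t+1)^(n-t-1), times (d-t)!.
-- Lower bound  d!/(d-t)! · (d-t+1)^(n-t)/(d-t+2), times (d-t)!(d-t+2).

-- Write k = t − 1. A word w·b is t-constrained iff w is and the letter b avoids the last k
-- letters of w. So the vertices of cDB⁺(d,t,n) arise by extending a first letter one letter at a
-- time, the j-th new letter having d − min(j,k) choices; this gives
-- |V| = d!/(d−t)!·(d−t+1)^(n−t), and every vertex has exactly d − t + 1 out-neighbours.
--
-- Lower bound: a vertex dominates at most d − t + 2 vertices, so γ·(d − t + 2) ≥ |V|.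
--
-- Upper bound: for each t-constrained word q of length n − 1 not starting with 0, let ℓ(q) be 0
-- if 0·q is t-constrained and q_k (0-based) otherwise; q_k differs from the k letters before it,
-- so ℓ(q)·q is a vertex. These (d−1)·(d−1)!/(d−t)!·(d−t+1)^(n−t−1) vertices dominate: a vertex
-- starting with 0 is one of them, and any other vertex p·b is an out-neighbour of ℓ(p)·p.

module Submission where

open import Defs
open import Data.Nat using (ℕ; zero; suc; _≤_; _<_; _∸_; _+_; _*_; _^_; _!; _⊓_; z≤n; s≤s)
open import Data.Nat.Properties
open import Data.Nat.Tactic.RingSolver using (solve-∀)
open import Data.Product using (∃-syntax; _×_; _,_; proj₁; proj₂)
open import Data.Sum using (_⊎_; inj₁; inj₂)
open import Data.Empty using (⊥; ⊥-elim)
open import Function using (id; _∘_)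
open import Level using (Level)
open import Relation.Nullary using (Dec; yes; no)
open import Relation.Unary using (Pred; Decidable)
open import Relation.Unary.Properties using (∁?)
open import Relation.Binary.PropositionalEquality hiding ([_])
open import Relation.Binary using (DecidableEquality)

open import Data.List using (List; []; _∷_; [_]; length; map; filter; concatMap; _++_; allFin)
open import Data.List.Properties using (length-++; length-map; length-tabulate; length-removeAt′)
open import Data.List.Membership.Propositional using (_∈_; _∉_; _─_; find; lose)
open import Data.List.Membership.Propositional.Properties
  using (∈-++⁺ˡ; ∈-++⁺ʳ; ∈-++⁻; ∈-map⁺; ∈-map⁻; ∈-filter⁺; ∈-filter⁻; ∈-concatMap⁺; ∈-concatMap⁻; ∈-allFin)
open import Data.List.Relation.Unary.Any using (Any; here; there; index)
import Data.List.Relation.Unary.Any as Any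
open import Data.List.Relation.Unary.All using (All)
import Data.List.Relation.Unary.All as All
open import Data.List.Relation.Unary.AllPairs using ([]; _∷_)
open import Data.List.Relation.Unary.Unique.Propositional using (Unique)
open import Data.List.Relation.Unary.Unique.Propositional.Properties using (++⁺; map⁺; filter⁺; allFin⁺)
open import Data.List.Extrema.Nat using (argmin; argmin-all; f[argmin]≤v⁺)

module _ {A : Set} where

  open import Data.List.Relation.Binary.Sublist.Propositional using ([]; _∷_; _∷ʳ_; ⊆-refl)
    renaming (_⊆_ to _⊑_)
  open import Data.List.Relation.Binary.Sublist.Propositional.Properties using (All-resp-⊆; filter-⊆)

  ∈-─⁺ : ∀ {x y : A} {xs} (x∈xs : x ∈ xs) → y ∈ xs → y ≢ x → y ∈ xs ─ x∈xs
  ∈-─⁺ (here refl) (here refl) y≢x = ⊥-elim (y≢x refl)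
  ∈-─⁺ (here refl) (there y∈xs) _ = y∈xs
  ∈-─⁺ (there x∈xs) (here refl) _ = here refl
  ∈-─⁺ (there x∈xs) (there y∈xs) y≢x = there (∈-─⁺ x∈xs y∈xs y≢x)

  Unique⇒length≤ : ∀ {xs ys : List A} → Unique xs → (∀ {z} → z ∈ xs → z ∈ ys) →
    length xs ≤ length ys
  Unique⇒length≤ {[]} _ _ = z≤n
  Unique⇒length≤ {x ∷ xs} {ys} (x∉xs ∷ xs!) xs⊆ys = begin
    suc (length xs)          ≤⟨ s≤s (Unique⇒length≤ xs! xs⊆ys─x) ⟩
    suc (length (ys ─ x∈ys)) ≡⟨ length-removeAt′ ys (index x∈ys) ⟨
    length ys                ∎
    where
    open ≤-Reasoning
    x∈ys = xs⊆ys (here refl)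
    xs⊆ys─x : ∀ {z} → z ∈ xs → z ∈ ys ─ x∈ys
    xs⊆ys─x z∈xs = ∈-─⁺ x∈ys (xs⊆ys (there z∈xs)) (≢-sym (All.lookup x∉xs z∈xs))

  Unique-resp-⊑ : ∀ {xs ys : List A} → xs ⊑ ys → Unique ys → Unique xs
  Unique-resp-⊑ [] [] = []
  Unique-resp-⊑ (_ ∷ʳ xs⊑ys) (_ ∷ ys!) = Unique-resp-⊑ xs⊑ys ys!
  Unique-resp-⊑ (refl ∷ xs⊑ys) (y∉ys ∷ ys!) = All-resp-⊆ xs⊑ys y∉ys ∷ Unique-resp-⊑ xs⊑ys ys!

  sublists : List A → List (List A)
  sublists []       = [ [] ]
  sublists (x ∷ xs) = sublists xs ++ map (x ∷_) (sublists xs)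

  ⊑⇒∈-sublists : ∀ {xs ys : List A} → xs ⊑ ys → xs ∈ sublists ys
  ⊑⇒∈-sublists [] = here refl
  ⊑⇒∈-sublists (_ ∷ʳ xs⊑ys) = ∈-++⁺ˡ (⊑⇒∈-sublists xs⊑ys)
  ⊑⇒∈-sublists {ys = y ∷ ys} (refl ∷ xs⊑ys) = ∈-++⁺ʳ (sublists ys) (∈-map⁺ (y ∷_) (⊑⇒∈-sublists xs⊑ys))

  ∈-sublists⇒⊑ : ∀ {xs : List A} ys → xs ∈ sublists ys → xs ⊑ ys
  ∈-sublists⇒⊑ [] (here refl) = []
  ∈-sublists⇒⊑ (y ∷ ys) xs∈ with ∈-++⁻ (sublists ys) xs∈
  ... | inj₁ xs∈′ = y ∷ʳ ∈-sublists⇒⊑ ys xs∈′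
  ... | inj₂ xs∈′ with ∈-map⁻ (y ∷_) xs∈′
  ...   | _ , zs∈ , refl = refl ∷ ∈-sublists⇒⊑ ys zs∈

  module _ {ℓ : Level} {P : Pred (List A) ℓ} (P? : Decidable P) where

    shortest-sublist : ∀ ys → P ys →
      ∃[ xs ] (xs ⊑ ys × P xs × (∀ {zs} → zs ⊑ ys → P zs → length xs ≤ length zs))
    shortest-sublist ys pys = xs , xs⊑ys , pxs ,
        λ zs⊑ys pzs → f[argmin]≤v⁺ ys candidates
          (inj₂ (Any.map (λ { refl → ≤-refl }) (∈-filter⁺ P? (⊑⇒∈-sublists zs⊑ys) pzs)))
      where
      candidates = filter P? (sublists ys)
      xs = argmin length ys candidates
      xs⊑ys×pxs : xs ⊑ ys × P xs
      xs⊑ys×pxs = argmin-all length {P = λ zs → zs ⊑ ys × P zs} (⊆-refl , pys)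
        (All.tabulate λ zs∈ → let zs∈′ , pzs = ∈-filter⁻ P? zs∈ in ∈-sublists⇒⊑ ys zs∈′ , pzs)
      xs⊑ys = proj₁ xs⊑ys×pxs
      pxs = proj₂ xs⊑ys×pxs

  module _ {B : Set} (f : B → List A) where

    length-concatMap : ∀ {c} xs → (∀ {x} → x ∈ xs → length (f x) ≡ c) →
      length (concatMap f xs) ≡ length xs * c
    length-concatMap [] _ = refl
    length-concatMap {c} (x ∷ xs) len-f = begin
      length (f x ++ concatMap f xs)          ≡⟨ length-++ (f x) ⟩
      length (f x) + length (concatMap f xs)  ≡⟨ cong₂ _+_ (len-f (here refl)) (length-concatMap xs (len-f ∘ there)) ⟩
      c + length xs * c                       ∎
      where open ≡-Reasoning

    concatMap-Unique : (g : A → B) → ∀ {xs} → Unique xs → (∀ {x} → x ∈ xs → Unique (f x)) →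
      (∀ {x y} → y ∈ f x → g y ≡ x) → Unique (concatMap f xs)
    concatMap-Unique g [] _ _ = []
    concatMap-Unique g {x ∷ xs} (x∉xs ∷ xs!) f! g-inv =
      ++⁺ (f! (here refl)) (concatMap-Unique g xs! (f! ∘ there) g-inv) disjoint
      where
      disjoint : ∀ {y} → y ∈ f x × y ∈ concatMap f xs → ⊥
      disjoint {y} (y∈fx , y∈rest) with find (∈-concatMap⁻ f {xs = xs} y∈rest)
      ... | x′ , x′∈xs , y∈fx′ = All.lookup x∉xs x′∈xs (trans (sym (g-inv y∈fx)) (g-inv y∈fx′))

  module _ {ℓ : Level} {P : Pred A ℓ} (P? : Decidable P) where

    length-filter+length-filter-∁ : ∀ xs →
      length (filter P? xs) + length (filter (∁? P?) xs) ≡ length xs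
    length-filter+length-filter-∁ [] = refl
    length-filter+length-filter-∁ (x ∷ xs) with P? x
    ... | yes _ = cong suc (length-filter+length-filter-∁ xs)
    ... | no _  = trans (+-suc _ _) (cong suc (length-filter+length-filter-∁ xs))

  module _ (_≟_ : DecidableEquality A) where

    open import Data.List.Membership.DecPropositional _≟_ using (_∈?_)

    length-filter-∉ : ∀ {xs ys} → Unique xs → Unique ys → (∀ {z} → z ∈ ys → z ∈ xs) →
      length (filter (∁? (_∈? ys)) xs) ≡ length xs ∸ length ys
    length-filter-∉ {xs} {ys} xs! ys! ys⊆xs = begin
      length (filter (∁? (_∈? ys)) xs)                 ≡⟨ m+n∸m≡n (length (filter (_∈? ys) xs)) _ ⟨
      length (filter (_∈? ys) xs) + length (filter (∁? (_∈? ys)) xs) ∸ length (filter (_∈? ys) xs)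
        ≡⟨ cong₂ _∸_ (length-filter+length-filter-∁ (_∈? ys) xs) common-length ⟩
      length xs ∸ length ys                            ∎
      where
      open ≡-Reasoning
      common-length : length (filter (_∈? ys) xs) ≡ length ys
      common-length = ≤-antisym
        (Unique⇒length≤ (filter⁺ (_∈? ys) xs!) (proj₂ ∘ ∈-filter⁻ (_∈? ys) {xs = xs}))
        (Unique⇒length≤ ys! (λ z∈ys → ∈-filter⁺ (_∈? ys) (ys⊆xs z∈ys) z∈ys))

    module _ {C : A → Set} {R : A → A → Set}
             (R? : ∀ u v → Dec (R u v)) (R-refl : ∀ v → R v v)
             {V : List A} (V! : Unique V) (V-sound : All C V) (V-complete : ∀ {v} → C v → v ∈ V) where

      IsDominating : List A → Set
      IsDominating S = Unique S × All C S × (∀ v → C v → ∃[ u ] (u ∈ S × R u v))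

      private
        Covers : List A → Set
        Covers S = All (λ v → Any (λ u → R u v) S) V

        covers? : Decidable Covers
        covers? S = All.all? (λ v → Any.any? (λ u → R? u v) S) V

      -- Restricting a dominating list to V keeps it dominating and does not make it longer,
      -- so a shortest one is found among the sublists of V.
      minimum-dominating : ∃[ S ] (IsDominating S × (∀ S′ → IsDominating S′ → length S ≤ length S′))
      minimum-dominating =
        let S , S⊑V , S-covers , S-shortest = shortest-sublist covers? V V-covers in
        S , (Unique-resp-⊑ S⊑V V! , All-resp-⊆ S⊑V V-sound , λ v cv → find (All.lookup S-covers (V-complete cv))) ,
        λ S′ S′-dom → ≤-trans (S-shortest (filter-⊆ (_∈? S′) V) (restriction-covers S′ S′-dom))
                              (Unique⇒length≤ (filter⁺ (_∈? S′) V!) (proj₂ ∘ ∈-filter⁻ (_∈? S′) {xs = V}))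
        where
        V-covers : Covers V
        V-covers = All.tabulate λ {v} v∈V → Any.map (λ { refl → R-refl v }) v∈V
        restriction-covers : ∀ S′ → IsDominating S′ → Covers (filter (_∈? S′) V)
        restriction-covers S′ (_ , S′-sound , S′-dom) = All.tabulate λ v∈V →
          let u , u∈S′ , r = S′-dom _ (All.lookup V-sound v∈V)
          in lose (∈-filter⁺ (_∈? S′) (V-complete (All.lookup S′-sound u∈S′)) u∈S′) r

-- Constrained words

open import Data.Fin using (Fin; zero; suc; toℕ; inject₁; fromℕ; fromℕ<)
open import Data.Fin.Properties using (toℕ-inject₁; toℕ-fromℕ; toℕ-fromℕ<; toℕ<n)
import Data.Fin.Properties as Fin
open import Data.Vec using (Vec; []; _∷_; _∷ʳ_; lookup; head; init; initLast)
open import Data.Vec.Properties using (∷-injective; ∷ʳ-injective; init-∷ʳ)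
import Data.Vec.Properties as Vec
open import Relation.Nullary.Decidable using (_×-dec_; _⊎-dec_; _→-dec_)

module _ {A : Set} where

  lookup-∷ʳ-inject₁ : ∀ {m} (w : Vec A m) b i → lookup (w ∷ʳ b) (inject₁ i) ≡ lookup w i
  lookup-∷ʳ-inject₁ (a ∷ w) b zero    = refl
  lookup-∷ʳ-inject₁ (a ∷ w) b (suc i) = lookup-∷ʳ-inject₁ w b i

  lookup-∷ʳ-fromℕ : ∀ {m} (w : Vec A m) b → lookup (w ∷ʳ b) (fromℕ m) ≡ b
  lookup-∷ʳ-fromℕ []      b = refl
  lookup-∷ʳ-fromℕ (a ∷ w) b = lookup-∷ʳ-fromℕ w b

  head-∷ʳ : ∀ {m} (w : Vec A (suc m)) b → head (w ∷ʳ b) ≡ head w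
  head-∷ʳ (a ∷ w) b = refl

inject₁-or-fromℕ : ∀ {m} (j : Fin (suc m)) → (∃[ i ] j ≡ inject₁ i) ⊎ j ≡ fromℕ m
inject₁-or-fromℕ {zero}  zero    = inj₂ refl
inject₁-or-fromℕ {suc m} zero    = inj₁ (zero , refl)
inject₁-or-fromℕ {suc m} (suc j) with inject₁-or-fromℕ j
... | inj₁ (i , refl) = inj₁ (suc i , refl)
... | inj₂ refl       = inj₂ refl

module _ {d : ℕ} where

  constrained? : ∀ {n} t (x : Seq d n) → Dec (Constrained t x)
  constrained? t x = Fin.all? λ i → Fin.all? λ j →
    (toℕ i <? toℕ j) →-dec ((lookup x i Fin.≟ lookup x j) →-dec (t ≤? toℕ j ∸ toℕ i))

  constrained-at : ∀ {t n} (x : Seq d n) → Constrained t x → ∀ i j {p q} → toℕ i ≡ p → toℕ j ≡ q →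
    p < q → lookup x i ≡ lookup x j → t ≤ q ∸ p
  constrained-at x c i j refl refl = c i j

  AvoidsPrefix : ∀ {m} → ℕ → Fin d → Seq d m → Set
  AvoidsPrefix t a v = ∀ j → suc (toℕ j) < t → a ≢ lookup v j

  Constrained-∷⁻ : ∀ {m t a} {v : Seq d m} → Constrained t (a ∷ v) → Constrained t v × AvoidsPrefix t a v
  Constrained-∷⁻ c = (λ i j i<j → c (suc i) (suc j) (s≤s i<j)) ,
                     (λ j j<t a≡vj → <⇒≱ j<t (c zero (suc j) (s≤s z≤n) a≡vj))

  Constrained-∷⁺ : ∀ {m t a} {v : Seq d m} → Constrained t v → AvoidsPrefix t a v → Constrained t (a ∷ v)
  Constrained-∷⁺ c avoids zero zero () _
  Constrained-∷⁺ {t = t} c avoids zero (suc j) _ a≡vj with t ≤? suc (toℕ j)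
  ... | yes t≤ = t≤
  ... | no t≰  = ⊥-elim (avoids j (≰⇒> t≰) a≡vj)
  Constrained-∷⁺ c avoids (suc i) zero () _
  Constrained-∷⁺ c avoids (suc i) (suc j) i<j = c i j (≤-pred i<j)

module _ {A : Set} where

  lastEntries : ∀ {m} → ℕ → Vec A m → List A
  lastEntries k [] = []
  lastEntries {suc m} k (a ∷ w) with suc m ≤? k
  ... | yes _ = a ∷ lastEntries k w
  ... | no _  = lastEntries k w

  length-lastEntries : ∀ {m} k (w : Vec A m) → length (lastEntries k w) ≡ m ⊓ k
  length-lastEntries k [] = refl
  length-lastEntries {suc m} k (a ∷ w) with suc m ≤? k
  ... | yes m<k = begin
    suc (length (lastEntries k w)) ≡⟨ cong suc (length-lastEntries k w) ⟩
    suc (m ⊓ k)                    ≡⟨ cong suc (m≤n⇒m⊓n≡m (<⇒≤ m<k)) ⟩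
    suc m                          ≡⟨ m≤n⇒m⊓n≡m m<k ⟨
    suc m ⊓ k                      ∎
    where open ≡-Reasoning
  ... | no m≮k = begin
    length (lastEntries k w) ≡⟨ length-lastEntries k w ⟩
    m ⊓ k                    ≡⟨ m≥n⇒m⊓n≡n (≤-pred (≰⇒> m≮k)) ⟩
    k                        ≡⟨ m≥n⇒m⊓n≡n (<⇒≤ (≰⇒> m≮k)) ⟨
    suc m ⊓ k                ∎
    where open ≡-Reasoning

  ∈-lastEntries⁻ : ∀ {m} k (w : Vec A m) {b} → b ∈ lastEntries k w → ∃[ i ] (m ∸ toℕ i ≤ k × lookup w i ≡ b)
  ∈-lastEntries⁻ {suc m} k (a ∷ w) b∈ with suc m ≤? k | b∈
  ... | yes m<k | here refl = zero , m<k , refl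
  ... | yes _   | there b∈′ = let i , i-late , wi≡b = ∈-lastEntries⁻ k w b∈′ in suc i , i-late , wi≡b
  ... | no _    | b∈′       = let i , i-late , wi≡b = ∈-lastEntries⁻ k w b∈′ in suc i , i-late , wi≡b

  ∈-lastEntries⁺ : ∀ {m} k (w : Vec A m) i → m ∸ toℕ i ≤ k → lookup w i ∈ lastEntries k w
  ∈-lastEntries⁺ {suc m} k (a ∷ w) i i-late with suc m ≤? k | i
  ... | yes _   | zero  = here refl
  ... | yes _   | suc i = there (∈-lastEntries⁺ k w i i-late)
  ... | no m≮k  | zero  = ⊥-elim (m≮k i-late)
  ... | no _    | suc i = ∈-lastEntries⁺ k w i i-late

module _ {d k : ℕ} where

  Constrained-∷ʳ⁻ : ∀ {m} (w : Seq d m) b → Constrained (suc k) (w ∷ʳ b) →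
    Constrained (suc k) w × b ∉ lastEntries k w
  Constrained-∷ʳ⁻ {m} w b c = c-init , b∉
    where
    c-init : Constrained (suc k) w
    c-init i j i<j wi≡wj = constrained-at (w ∷ʳ b) c (inject₁ i) (inject₁ j) (toℕ-inject₁ i) (toℕ-inject₁ j) i<j
      (trans (lookup-∷ʳ-inject₁ w b i) (trans wi≡wj (sym (lookup-∷ʳ-inject₁ w b j))))
    b∉ : b ∉ lastEntries k w
    b∉ b∈ with ∈-lastEntries⁻ k w b∈
    ... | i , i-late , wi≡b = ≤⇒≯ i-late
      (constrained-at (w ∷ʳ b) c (inject₁ i) (fromℕ m) (toℕ-inject₁ i) (toℕ-fromℕ m) (toℕ<n i)
        (trans (lookup-∷ʳ-inject₁ w b i) (trans wi≡b (sym (lookup-∷ʳ-fromℕ w b)))))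

  Constrained-∷ʳ⁺ : ∀ {m} (w : Seq d m) b → Constrained (suc k) w → b ∉ lastEntries k w →
    Constrained (suc k) (w ∷ʳ b)
  Constrained-∷ʳ⁺ {m} w b c b∉ i j i<j eq with inject₁-or-fromℕ i | inject₁-or-fromℕ j
  ... | inj₁ (i′ , refl) | inj₁ (j′ , refl) rewrite toℕ-inject₁ i′ | toℕ-inject₁ j′ =
    c i′ j′ i<j (trans (sym (lookup-∷ʳ-inject₁ w b i′)) (trans eq (lookup-∷ʳ-inject₁ w b j′)))
  ... | inj₂ refl | inj₁ (j′ , refl) rewrite toℕ-inject₁ j′ | toℕ-fromℕ m = ⊥-elim (<-asym i<j (toℕ<n j′))
  ... | inj₂ refl | inj₂ refl = ⊥-elim (<-irrefl refl i<j)
  ... | inj₁ (i′ , refl) | inj₂ refl rewrite toℕ-inject₁ i′ | toℕ-fromℕ m with suc k ≤? m ∸ toℕ i′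
  ...   | yes far = far
  ...   | no near = ⊥-elim (b∉ (subst (_∈ lastEntries k w) wi′≡b (∈-lastEntries⁺ k w i′ (≤-pred (≰⇒> near)))))
    where wi′≡b = trans (sym (lookup-∷ʳ-inject₁ w b i′)) (trans eq (lookup-∷ʳ-fromℕ w b))

  lastEntries-Unique : ∀ {m} (w : Seq d m) → Constrained (suc k) w → Unique (lastEntries k w)
  lastEntries-Unique [] c = []
  lastEntries-Unique {suc m} (a ∷ w) c with suc m ≤? k | Constrained-∷⁻ c
  ... | yes m<k | c-w , a-avoids = All.tabulate a∉ ∷ lastEntries-Unique w c-w
    where
    a∉ : ∀ {b} → b ∈ lastEntries k w → a ≢ b
    a∉ b∈ a≡b with ∈-lastEntries⁻ k w b∈
    ... | i , _ , wi≡b = a-avoids i (s≤s (≤-trans (toℕ<n i) (<⇒≤ m<k))) (trans a≡b (sym wi≡b))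
  ... | no _    | c-w , _ = lastEntries-Unique w c-w

-- Enumerating constrained words

length-allFin : ∀ n → length (allFin n) ≡ n
length-allFin n = length-tabulate id

-- The number of ways to extend a first letter to a (k+1)-constrained word of length m + 1.
choices : ℕ → ℕ → ℕ → ℕ
choices d k zero    = 1
choices d k (suc m) = choices d k m * (d ∸ suc m ⊓ k)

choices*factorial : ∀ {d k} j → j ≤ k → k ≤ d → choices (suc d) k j * (d ∸ j) ! ≡ d !
choices*factorial zero _ _ = +-identityʳ _
choices*factorial {d} {k} (suc j) j<k k≤d = begin
  choices (suc d) k j * (suc d ∸ suc j ⊓ k) * (d ∸ suc j) !
    ≡⟨ cong (λ x → choices (suc d) k j * (suc d ∸ x) * (d ∸ suc j) !) (m≤n⇒m⊓n≡m j<k) ⟩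
  choices (suc d) k j * (d ∸ j) * (d ∸ suc j) !   ≡⟨ *-assoc (choices (suc d) k j) _ _ ⟩
  choices (suc d) k j * ((d ∸ j) * (d ∸ suc j) !) ≡⟨ cong (choices (suc d) k j *_) factorial-step ⟩
  choices (suc d) k j * (d ∸ j) !                 ≡⟨ choices*factorial j (<⇒≤ j<k) k≤d ⟩
  d !                                             ∎
  where
  open ≡-Reasoning
  factorial-step : (d ∸ j) * (d ∸ suc j) ! ≡ (d ∸ j) !
  factorial-step rewrite +-∸-assoc 1 (≤-trans j<k k≤d) = refl

choices-+ : ∀ {d k} i → choices d k (i + k) ≡ choices d k k * (d ∸ k) ^ i
choices-+ zero = sym (*-identityʳ _)
choices-+ {d} {k} (suc i) = begin
  choices d k (i + k) * (d ∸ suc (i + k) ⊓ k)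
    ≡⟨ cong (λ x → choices d k (i + k) * (d ∸ x)) (m≥n⇒m⊓n≡n (m≤n⇒m≤1+n (m≤n+m k i))) ⟩
  choices d k (i + k) * (d ∸ k)           ≡⟨ cong (_* (d ∸ k)) (choices-+ i) ⟩
  choices d k k * (d ∸ k) ^ i * (d ∸ k)   ≡⟨ *-assoc (choices d k k) _ _ ⟩
  choices d k k * ((d ∸ k) ^ i * (d ∸ k)) ≡⟨ cong (choices d k k *_) (*-comm ((d ∸ k) ^ i) (d ∸ k)) ⟩
  choices d k k * (d ∸ k) ^ suc i         ∎
  where open ≡-Reasoning

choices-closed : ∀ {d k m} → k ≤ m → k ≤ d → choices (suc d) k m * (d ∸ k) ! ≡ d ! * (d ∸ k + 1) ^ (m ∸ k)
choices-closed {d} {k} {m} k≤m k≤d = begin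
  choices (suc d) k m * (d ∸ k) !                         ≡⟨ cong (λ x → choices (suc d) k x * (d ∸ k) !) (m∸n+n≡m k≤m) ⟨
  choices (suc d) k (m ∸ k + k) * (d ∸ k) !               ≡⟨ cong (_* (d ∸ k) !) (choices-+ (m ∸ k)) ⟩
  choices (suc d) k k * (suc d ∸ k) ^ (m ∸ k) * (d ∸ k) ! ≡⟨ *-comm (choices (suc d) k k * _) _ ⟩
  (d ∸ k) ! * (choices (suc d) k k * (suc d ∸ k) ^ (m ∸ k)) ≡⟨ *-assoc ((d ∸ k) !) _ _ ⟨
  (d ∸ k) ! * choices (suc d) k k * (suc d ∸ k) ^ (m ∸ k) ≡⟨ cong₂ (λ x y → x * y ^ (m ∸ k)) prefix shifted ⟩
  d ! * (d ∸ k + 1) ^ (m ∸ k)                             ∎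
  where
  open ≡-Reasoning
  prefix : (d ∸ k) ! * choices (suc d) k k ≡ d !
  prefix = trans (*-comm ((d ∸ k) !) _) (choices*factorial k ≤-refl k≤d)
  shifted : suc d ∸ k ≡ d ∸ k + 1
  shifted = trans (+-∸-assoc 1 k≤d) (+-comm 1 (d ∸ k))

module _ {d : ℕ} (k : ℕ) where

  open import Data.List.Membership.DecPropositional (Fin._≟_ {d}) using (_∈?_)

  extensions : ∀ {m} → Seq d m → List (Fin d)
  extensions w = filter (∁? (_∈? lastEntries k w)) (allFin d)

  length-extensions : ∀ {m} (w : Seq d m) → Constrained (suc k) w → length (extensions w) ≡ d ∸ m ⊓ k
  length-extensions w c =
    trans (length-filter-∉ Fin._≟_ (allFin⁺ d) (lastEntries-Unique w c) (λ _ → ∈-allFin _))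
          (cong₂ _∸_ (length-allFin d) (length-lastEntries k w))

  children : ∀ {m} → Seq d m → List (Seq d (suc m))
  children w = map (w ∷ʳ_) (extensions w)

  length-children : ∀ {m} (w : Seq d m) → Constrained (suc k) w → length (children w) ≡ d ∸ m ⊓ k
  length-children w c = trans (length-map (w ∷ʳ_) (extensions w)) (length-extensions w c)

  ∈-children⁺ : ∀ {m} {w : Seq d m} {b} → Constrained (suc k) (w ∷ʳ b) → w ∷ʳ b ∈ children w
  ∈-children⁺ {w = w} c = ∈-map⁺ (w ∷ʳ_) (∈-filter⁺ _ (∈-allFin _) (proj₂ (Constrained-∷ʳ⁻ w _ c)))

  ∈-children⁻ : ∀ {m} {w : Seq d m} {v} → v ∈ children w → ∃[ b ] (b ∉ lastEntries k w × v ≡ w ∷ʳ b)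
  ∈-children⁻ {w = w} v∈ with ∈-map⁻ (w ∷ʳ_) v∈
  ... | b , b∈ , refl = b , proj₂ (∈-filter⁻ _ {xs = allFin d} b∈) , refl

  constrainedSeqs : List (Fin d) → (m : ℕ) → List (Seq d (suc m))
  constrainedSeqs B zero    = map (_∷ []) B
  constrainedSeqs B (suc m) = concatMap children (constrainedSeqs B m)

  ∈-constrainedSeqs⁻ : ∀ B m {v} → v ∈ constrainedSeqs B m → Constrained (suc k) v × head v ∈ B
  ∈-constrainedSeqs⁻ B zero v∈ with ∈-map⁻ (_∷ []) v∈
  ... | a , a∈B , refl = (λ { zero zero () }) , a∈B
  ∈-constrainedSeqs⁻ B (suc m) v∈ with find (∈-concatMap⁻ children {xs = constrainedSeqs B m} v∈)
  ... | w , w∈ , v∈′ with ∈-constrainedSeqs⁻ B m w∈ | ∈-children⁻ v∈′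
  ...   | c , head∈B | b , b∉ , refl = Constrained-∷ʳ⁺ w b c b∉ , subst (_∈ B) (sym (head-∷ʳ w b)) head∈B

  ∈-constrainedSeqs⁺ : ∀ B m (v : Seq d (suc m)) → Constrained (suc k) v → head v ∈ B → v ∈ constrainedSeqs B m
  ∈-constrainedSeqs⁺ B zero (a ∷ []) _ a∈B = ∈-map⁺ (_∷ []) a∈B
  ∈-constrainedSeqs⁺ B (suc m) v c head∈B with initLast v
  ... | w , b , refl = ∈-concatMap⁺ children
    (lose (∈-constrainedSeqs⁺ B m w (proj₁ (Constrained-∷ʳ⁻ w b c)) (subst (_∈ B) (head-∷ʳ w b) head∈B))
          (∈-children⁺ c))

  constrainedSeqs-Unique : ∀ {B} m → Unique B → Unique (constrainedSeqs B m)
  constrainedSeqs-Unique zero B! = map⁺ (λ eq → proj₁ (∷-injective eq)) B!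
  constrainedSeqs-Unique (suc m) B! = concatMap-Unique children init (constrainedSeqs-Unique m B!)
    (λ {w} _ → map⁺ (λ eq → proj₂ (∷ʳ-injective w w eq)) (filter⁺ _ (allFin⁺ d)))
    (λ {w} v∈ → let b , _ , v≡ = ∈-children⁻ v∈ in trans (cong init v≡) (init-∷ʳ b w))

  length-constrainedSeqs : ∀ B m → length (constrainedSeqs B m) ≡ length B * choices d k m
  length-constrainedSeqs B zero = trans (length-map (_∷ []) B) (sym (*-identityʳ _))
  length-constrainedSeqs B (suc m) = begin
    length (concatMap children (constrainedSeqs B m))  ≡⟨ length-concatMap children _ children-count ⟩
    length (constrainedSeqs B m) * (d ∸ suc m ⊓ k)    ≡⟨ cong (_* _) (length-constrainedSeqs B m) ⟩
    length B * choices d k m * (d ∸ suc m ⊓ k)         ≡⟨ *-assoc (length B) _ _ ⟩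
    length B * choices d k (suc m)                     ∎
    where
    open ≡-Reasoning
    children-count : ∀ {w} → w ∈ constrainedSeqs B m → length (children w) ≡ d ∸ suc m ⊓ k
    children-count {w} w∈ = length-children w (proj₁ (∈-constrainedSeqs⁻ B m w∈))

-- Domination in cDB⁺(d,t,n)

module _ {d : ℕ} where

  shift? : ∀ {m} (u v : Seq d (suc m)) → Dec (Shift u v)
  shift? (a ∷ w) v with initLast v
  ... | w′ , b , v≡w′b with Vec.≡-dec Fin._≟_ w w′
  ...   | yes refl = yes (a , b , w , refl , v≡w′b)
  ...   | no w≢w′  = no λ { (_ , b′ , w″ , a∷w≡ , v≡w″b′) →
            w≢w′ (trans (proj₂ (∷-injective a∷w≡)) (proj₁ (∷ʳ-injective w″ w′ (trans (sym v≡w″b′) v≡w′b)))) }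

  dominates? : ∀ {m} t (u v : Seq d (suc m)) → Dec (Dominates t u v)
  dominates? t u v = Vec.≡-dec Fin._≟_ u v ⊎-dec (constrained? t u ×-dec constrained? t v ×-dec shift? u v)

vertices : ∀ d k m → List (Seq d (suc m))
vertices d k m = constrainedSeqs k (allFin d) m

module _ {d k m : ℕ} where

  ∈-vertices : ∀ {v : Seq d (suc m)} → Constrained (suc k) v → v ∈ vertices d k m
  ∈-vertices {v} c = ∈-constrainedSeqs⁺ k (allFin d) m v c (∈-allFin (head v))

  length-vertices : length (vertices d k m) ≡ d * choices d k m
  length-vertices = trans (length-constrainedSeqs k (allFin d) m) (cong (_* choices d k m) (length-allFin d))

  closedNeighbourhood : Seq d (suc m) → List (Seq d (suc m))
  closedNeighbourhood (a ∷ w) = (a ∷ w) ∷ children k w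

  ∈-closedNeighbourhood : ∀ {u v} → Constrained (suc k) v → Dominates (suc k) u v → v ∈ closedNeighbourhood u
  ∈-closedNeighbourhood {a ∷ w} _ (inj₁ refl) = here refl
  ∈-closedNeighbourhood {a ∷ w} c (inj₂ (_ , _ , _ , b , _ , a∷w≡ , refl)) with ∷-injective a∷w≡
  ... | refl , refl = there (∈-children⁺ k c)

  length-closedNeighbourhood : k ≤ m → ∀ u → Constrained (suc k) u → length (closedNeighbourhood u) ≡ suc (d ∸ k)
  length-closedNeighbourhood k≤m (a ∷ w) c =
    cong suc (trans (length-children k w (proj₁ (Constrained-∷⁻ c))) (cong (d ∸_) (m≥n⇒m⊓n≡n k≤m)))

  length-vertices≤ : k ≤ m → ∀ {S} → IsDominatingSet d (suc k) (suc m) S →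
    length (vertices d k m) ≤ length S * suc (d ∸ k)
  length-vertices≤ k≤m {S} (_ , S-sound , S-dom) = begin
    length (vertices d k m)                 ≤⟨ Unique⇒length≤ (constrainedSeqs-Unique k m (allFin⁺ d)) covered ⟩
    length (concatMap closedNeighbourhood S) ≡⟨ length-concatMap closedNeighbourhood S
                                                  (λ {u} u∈S → length-closedNeighbourhood k≤m u (All.lookup S-sound u∈S)) ⟩
    length S * suc (d ∸ k)                  ∎
    where
    open ≤-Reasoning
    covered : ∀ {v} → v ∈ vertices d k m → v ∈ concatMap closedNeighbourhood S
    covered v∈ = let c = proj₁ (∈-constrainedSeqs⁻ k (allFin d) m v∈)
                     u , u∈S , u→v = S-dom _ c
                 in ∈-concatMap⁺ closedNeighbourhood (lose u∈S (∈-closedNeighbourhood c u→v))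

lookup-avoidsPrefix : ∀ {d m k} {q : Seq d m} → Constrained (suc k) q →
  ∀ ι → toℕ ι ≡ k → AvoidsPrefix (suc k) (lookup q ι) q
lookup-avoidsPrefix {q = q} c ι ι≡k j j<k qι≡qj =
  ≤⇒≯ (≤-trans (m∸n≤m (toℕ ι) (toℕ j)) (≤-reflexive ι≡k))
      (c j ι (subst (toℕ j <_) (sym ι≡k) (≤-pred j<k)) (sym qι≡qj))

module _ {d k m : ℕ} (k≤m : k ≤ m) where

  leader : Seq (suc d) (suc m) → Fin (suc d)
  leader q with constrained? (suc k) (zero ∷ q)
  ... | yes _ = zero
  ... | no _  = lookup q (fromℕ< (s≤s k≤m))

  leader-∷-constrained : ∀ {q} → Constrained (suc k) q → Constrained (suc k) (leader q ∷ q)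
  leader-∷-constrained {q} c with constrained? (suc k) (zero ∷ q)
  ... | yes c′ = c′
  ... | no _   = Constrained-∷⁺ c (lookup-avoidsPrefix {q = q} c (fromℕ< (s≤s k≤m)) (toℕ-fromℕ< (s≤s k≤m)))

  leader≡zero : ∀ {q} → Constrained (suc k) (zero ∷ q) → leader q ≡ zero
  leader≡zero {q} c with constrained? (suc k) (zero ∷ q)
  ... | yes _ = refl
  ... | no ¬c = ⊥-elim (¬c c)

  leaderSet : List (Seq (suc d) (suc (suc m)))
  leaderSet = map (λ q → leader q ∷ q) (constrainedSeqs k (map suc (allFin d)) m)

  length-leaderSet : length leaderSet ≡ d * choices (suc d) k m
  length-leaderSet = begin
    length leaderSet                                   ≡⟨ length-map _ (constrainedSeqs k (map suc (allFin d)) m) ⟩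
    length (constrainedSeqs k (map suc (allFin d)) m) ≡⟨ length-constrainedSeqs k (map suc (allFin d)) m ⟩
    length (map suc (allFin d)) * choices (suc d) k m  ≡⟨ cong (_* choices (suc d) k m) (trans (length-map suc (allFin d)) (length-allFin d)) ⟩
    d * choices (suc d) k m                            ∎
    where open ≡-Reasoning

  leaderSet-dominating : 1 ≤ k → IsDominatingSet (suc d) (suc k) (suc (suc m)) leaderSet
  leaderSet-dominating 1≤k =
    map⁺ (λ eq → proj₂ (∷-injective eq)) (constrainedSeqs-Unique k m (map⁺ Fin.suc-injective (allFin⁺ d))) ,
    All.tabulate sound , dominated
    where
    seeds = constrainedSeqs k (map suc (allFin d)) m

    seed : ∀ {q} → Constrained (suc k) q → head q ≢ zero → q ∈ seeds
    seed {q} c head≢0 = ∈-constrainedSeqs⁺ k _ m q c (nonzero (head q) head≢0)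
      where
      nonzero : ∀ b → b ≢ zero → b ∈ map suc (allFin d)
      nonzero zero    b≢0 = ⊥-elim (b≢0 refl)
      nonzero (suc b) _   = ∈-map⁺ suc (∈-allFin b)

    sound : ∀ {v} → v ∈ leaderSet → Constrained (suc k) v
    sound v∈ with ∈-map⁻ (λ q → leader q ∷ q) v∈
    ... | q , q∈ , refl = leader-∷-constrained (proj₁ (∈-constrainedSeqs⁻ k _ m q∈))

    dominated : ∀ v → Constrained (suc k) v → ∃[ u ] (u ∈ leaderSet × Dominates (suc k) u v)
    dominated (zero ∷ q@(b ∷ _)) c =
      zero ∷ q ,
      subst (λ a → a ∷ q ∈ leaderSet) (leader≡zero c) (∈-map⁺ (λ q → leader q ∷ q) (seed c-q b≢0)) ,
      inj₁ refl
      where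
      c-q = proj₁ (Constrained-∷⁻ c)
      b≢0 : b ≢ zero
      b≢0 b≡0 = proj₂ (Constrained-∷⁻ c) zero (s≤s 1≤k) (sym b≡0)
    dominated v@(suc a ∷ _) c with initLast v
    ... | p , b , v≡pb =
      leader p ∷ p ,
      ∈-map⁺ (λ q → leader q ∷ q) (seed c-p head≢0) ,
      inj₂ (leader-∷-constrained c-p , c , leader p , b , p , refl , v≡pb)
      where
      c-p = proj₁ (Constrained-∷ʳ⁻ p b (subst (Constrained (suc k)) v≡pb c))
      head≢0 : head p ≢ zero
      head≢0 head≡0 with trans (cong head v≡pb) (trans (head-∷ʳ p b) head≡0)
      ... | ()

minimum-dominating-set : ∀ {d t n} → 1 ≤ t → 1 ≤ n →
  ∃[ S ] (IsDominatingSet d t n S × (∀ S′ → IsDominatingSet d t n S′ → length S ≤ length S′))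
minimum-dominating-set {d} {suc k} {suc m} _ _ =
  minimum-dominating (Vec.≡-dec Fin._≟_) (dominates? (suc k)) (λ _ → inj₁ refl)
    (constrainedSeqs-Unique k m (allFin⁺ d))
    (All.tabulate (proj₁ ∘ ∈-constrainedSeqs⁻ k (allFin d) m))
    ∈-vertices

lower-bound : ∀ {d t n S} → 1 ≤ t → t ≤ d → t ≤ n → IsDominatingSet d t n S →
  d ! * (d ∸ t + 1) ^ (n ∸ t) ≤ length S * ((d ∸ t) ! * (d ∸ t + 2))
lower-bound {suc d} {suc k} {suc m} {S} _ (s≤s k≤d) (s≤s k≤m) S-dom = begin
  suc d ! * (d ∸ k + 1) ^ (m ∸ k)           ≡⟨ *-assoc (suc d) (d !) _ ⟩
  suc d * (d ! * (d ∸ k + 1) ^ (m ∸ k))     ≡⟨ cong (suc d *_) (choices-closed k≤m k≤d) ⟨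
  suc d * (choices (suc d) k m * (d ∸ k) !) ≡⟨ *-assoc (suc d) (choices (suc d) k m) ((d ∸ k) !) ⟨
  suc d * choices (suc d) k m * (d ∸ k) !   ≡⟨ cong (_* (d ∸ k) !) (length-vertices {suc d} {k} {m}) ⟨
  length (vertices (suc d) k m) * (d ∸ k) ! ≤⟨ *-monoˡ-≤ ((d ∸ k) !) (length-vertices≤ {suc d} k≤m S-dom) ⟩
  length S * suc (suc d ∸ k) * (d ∸ k) !    ≡⟨ cong (λ x → length S * x * (d ∸ k) !) neighbourhood-size ⟩
  length S * (d ∸ k + 2) * (d ∸ k) !        ≡⟨ *-assoc (length S) _ _ ⟩
  length S * ((d ∸ k + 2) * (d ∸ k) !)      ≡⟨ cong (length S *_) (*-comm (d ∸ k + 2) _) ⟩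
  length S * ((d ∸ k) ! * (d ∸ k + 2))      ∎
  where
  open ≤-Reasoning
  neighbourhood-size : suc (suc d ∸ k) ≡ d ∸ k + 2
  neighbourhood-size = trans (cong suc (+-∸-assoc 1 k≤d)) (+-comm 2 (d ∸ k))

upper-bound : ∀ {d t n} → 2 ≤ t → t ≤ d → t < n →
  ∃[ S ] (IsDominatingSet d t n S × length S * (d ∸ t) ! ≡ (d ∸ 1) * (d ∸ 1) ! * (d ∸ t + 1) ^ (n ∸ t ∸ 1))
upper-bound {suc d} {suc k} {suc (suc m)} (s≤s 1≤k) (s≤s k≤d) (s≤s (s≤s k≤m)) =
  leaderSet k≤m , leaderSet-dominating k≤m 1≤k , (begin
    length (leaderSet k≤m) * (d ∸ k) !     ≡⟨ cong (_* (d ∸ k) !) (length-leaderSet k≤m) ⟩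
    d * choices (suc d) k m * (d ∸ k) !    ≡⟨ *-assoc d _ _ ⟩
    d * (choices (suc d) k m * (d ∸ k) !)  ≡⟨ cong (d *_) (choices-closed k≤m k≤d) ⟩
    d * (d ! * (d ∸ k + 1) ^ (m ∸ k))      ≡⟨ *-assoc d (d !) _ ⟨
    d * d ! * (d ∸ k + 1) ^ (m ∸ k)        ≡⟨ cong (λ e → d * d ! * (d ∸ k + 1) ^ (e ∸ 1)) (+-∸-assoc 1 k≤m) ⟨
    d * d ! * (d ∸ k + 1) ^ (suc m ∸ k ∸ 1) ∎)
  where open ≡-Reasoning

-- With s = t − 2, a = d − t, F = (d − 1)! and Y = (d − t + 1)^(n − t − 1).
ratio-polynomial : ∀ s a F Y →
  suc (s + a) * F * Y * (suc (suc (s + a)) * (a + 1)) * (a + 2)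
    ≡ suc (suc (s + a)) * F * ((a + 1) * Y) * (suc (suc (s + a)) * (a + 1) + s)
ratio-polynomial = solve-∀

upper-bound-ratio : ∀ {d t n} → 2 ≤ t → t ≤ d → t < n →
  (d ∸ 1) * (d ∸ 1) ! * (d ∸ t + 1) ^ (n ∸ t ∸ 1) * (d * (d ∸ t + 1)) * (d ∸ t + 2)
    ≡ d ! * (d ∸ t + 1) ^ (n ∸ t) * (d * (d ∸ t + 1) + (t ∸ 2))
upper-bound-ratio {suc d} {suc (suc s)} {suc (suc m)} (s≤s (s≤s z≤n)) (s≤s s<d) (s≤s (s≤s s<m))
  rewrite +-∸-assoc 1 s<m = generalised (m+[n∸m]≡n s<d)
  where
  generalised : ∀ {a d} → suc s + a ≡ d →
    d * d ! * (a + 1) ^ (m ∸ suc s) * (suc d * (a + 1)) * (a + 2)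
      ≡ suc d ! * (a + 1) ^ suc (m ∸ suc s) * (suc d * (a + 1) + s)
  generalised {a} refl = ratio-polynomial s a ((suc s + a) !) ((a + 1) ^ (m ∸ suc s))

theorem11 : ∀ (d t n : ℕ) → 2 ≤ t → t ≤ d → t < n →
    ∃[ γ ] (IsDominationNumber d t n γ
    × (d ! * (d ∸ t + 1) ^ (n ∸ t) ≤ γ * ((d ∸ t) ! * (d ∸ t + 2)))
    × (γ * (d ∸ t) ! ≤ (d ∸ 1) * (d ∸ 1) ! * (d ∸ t + 1) ^ (n ∸ t ∸ 1))
    × ((d ∸ 1) * (d ∸ 1) ! * (d ∸ t + 1) ^ (n ∸ t ∸ 1) * (d * (d ∸ t + 1)) * (d ∸ t + 2)
    ≡ d ! * (d ∸ t + 1) ^ (n ∸ t) * (d * (d ∸ t + 1) + (t ∸ 2))))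
theorem11 d t n 2≤t t≤d t<n =
  length S , ((S , S-dom , refl) , S-min) ,
  lower-bound 1≤t t≤d (<⇒≤ t<n) S-dom ,
  ≤-trans (*-monoˡ-≤ ((d ∸ t) !) (S-min S′ S′-dom)) (≤-reflexive |S′|) ,
  upper-bound-ratio 2≤t t≤d t<n
  where
  1≤t = ≤-trans (s≤s z≤n) 2≤t
  minimum = minimum-dominating-set {d} 1≤t (≤-trans 1≤t (<⇒≤ t<n))
  S = proj₁ minimum
  S-dom = proj₁ (proj₂ minimum)
  S-min = proj₂ (proj₂ minimum)
  upper = upper-bound 2≤t t≤d t<n
  S′ = proj₁ upper
  S′-dom = proj₁ (proj₂ upper)
  |S′| = proj₂ (proj₂ upper)
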